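{- Let $k\ge 3$ and $D:=3k$. Let $H$ be a $k$-uniform hypergraph on $n$ vertices with an $r$-colouring $c:E(H)\to\{C_1,\dots,C_r\}$. Suppose there exist $i\ne j\in[r]$ and distinct vertices $v_1,v_2,v_3,v_4\in V(H)$ such that $N_H(v_1)\cap N_H(v_2)$ and $N_H(v_3)\cap N_H(v_4)$ are both of type $C_iC_j(D)$, i.e. $|C_iC_j(v_1v_2)|\ge Dn^{k-2}$ and $|C_iC_j(v_3v_4)|\ge Dn^{k-2}$. If $$\delta_2(H)>\frac12\binom{n}{k-2},$$ then there exist $e,f\in E(H)$ and a good $(3k,e,f)$-gadget in $H$.
   Context: For a $k$-uniform hypergraph $H$, $\delta_2(H)$ is the minimum, over all 2-element sets $S\subseteq V(H)$, of the number of edges containing $S$. For $X\subseteq V(H)$, the neighbourhood $N_H(X)$ is the family of sets $S\subseteq V(H)\setminus X$ with $S\cup X\in E(H)$; $N_H(x):=N_H(\{x\})$ (so its members are $(k-1)$-sets). For distinct $u,v\in V(H)$, $C_iC_j(uv)$ denotes the collection of sets $T\in N_H(u)\cap N_H(v)$ with $c(T\cup\{u\})=C_i$ and $c(T\cup\{v\})=C_j$. The colour profile of a subhypergraph $F$ is $(x_1,\dots,x_r)$ where $x_i$ is the number of edges of $F$ coloured $C_i$. Given edges $e=\{e_1,\dots,e_k\}$, $f=\{f_1,\dots,f_k\}$ of $H$, a $(3k,e,f)$-gadget is a subhypergraph $G$ of $H$ on $3k$ vertices such that: $e_i=f_i$ for all $i\in\{3,\dots,k\}$; $V(G)$ is the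 disjoint union of $e$, $\{f_1\}$, $\{f_2\}$, $T_1$, $T_2$ where $T_i\in N_H(e_i)\cap N_H(f_i)$ for $i\in[2]$; $e,f\in E(G)$; and $e_1\cup T_1, f_1\cup T_1, e_2\cup T_2, f_2\cup T_2\in E(G)$. Such a gadget is good if it contains two perfect matchings with different colour profiles (with respect to the colouring induced by $c$). -}

module Defs where

open import Data.Bool using (Bool; true; false; _∧_; not; if_then_else_)
open import Data.Nat using (ℕ; zero; suc; _+_)
open import Data.Fin using (Fin)
open import Data.Fin.Properties using () renaming (_≟_ to _≟ᶠ_)
open import Data.Fin.Subset using (Subset; ⁅_⁆; _∪_; _∩_; ⊥; ⋃; ∣_∣; _∈_; _∉_; _⊆_)
open import Data.Vec using (Vec; []; _∷_; lookup)
open import Data.List using (List; []; _∷_; map; _++_; length)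
open import Data.List.Relation.Unary.All using (All)
open import Data.List.Relation.Unary.AllPairs using (AllPairs)
open import Data.Product using (Σ; _×_; _,_)
open import Relation.Binary.PropositionalEquality using (_≡_; _≢_)
open import Relation.Nullary using (¬_)
open import Relation.Nullary.Decidable using (⌊_⌋)

allSubsets : (n : ℕ) → List (Subset n)
allSubsets zero    = [] ∷ []
allSubsets (suc n) = map (false ∷_) (allSubsets n) ++ map (true ∷_) (allSubsets n)

countSubsets : {n : ℕ} → (Subset n → Bool) → ℕ
countSubsets {n} P = go (allSubsets n)
  where
  go : List (Subset n) → ℕ
  go []       = zero
  go (s ∷ ss) = if P s then suc (go ss) else go ss

record Hypergraph (k n : ℕ) : Set where
  field
    E       : Subset n → Bool
    uniform : ∀ s → E s ≡ true → ∣ s ∣ ≡ k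
open Hypergraph public

-- An r-colouring of the edges: c : E(H) → {C_1,…,C_r} (colours = Fin r).
-- We take c as a total function on subsets; only its values on edges matter.
Colouring : (n r : ℕ) → Set
Colouring n r = Subset n → Fin r

codeg : {k n : ℕ} → Hypergraph k n → Fin n → Fin n → ℕ
codeg H u v = countSubsets (λ s → E H s ∧ lookup s u ∧ lookup s v)

CiCj : {k n r : ℕ} → Hypergraph k n → Colouring n r →
       Fin r → Fin r → Fin n → Fin n → ℕ
CiCj H c i j u v = countSubsets (λ T →
  not (lookup T u) ∧ not (lookup T v) ∧
  E H (T ∪ ⁅ u ⁆) ∧ E H (T ∪ ⁅ v ⁆) ∧
  ⌊ c (T ∪ ⁅ u ⁆) ≟ᶠ i ⌋ ∧ ⌊ c (T ∪ ⁅ v ⁆) ≟ᶠ j ⌋)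

Disjoint : {n : ℕ} → Subset n → Subset n → Set
Disjoint s t = s ∩ t ≡ ⊥

InNbhd : {k n : ℕ} → Hypergraph k n → Fin n → Subset n → Set
InNbhd H x T = (x ∉ T) × (E H (T ∪ ⁅ x ⁆) ≡ true)

colourCount : {n r : ℕ} → Colouring n r → List (Subset n) → Fin r → ℕ
colourCount c []       i = zero
colourCount c (s ∷ ss) i =
  if ⌊ c s ≟ᶠ i ⌋ then suc (colourCount c ss i) else colourCount c ss i

IsPerfectMatching : {n : ℕ} → Subset n → (Subset n → Bool) → List (Subset n) → Set
IsPerfectMatching V EG M =
  All (λ s → EG s ≡ true) M × AllPairs Disjoint M × ⋃ M ≡ V

-- A (3k,e,f)-gadget in H.  It records the labelling
--   e = {e₁,e₂} ∪ S,  f = {f₁,f₂} ∪ S  (S = {e₃,…,e_k} = {f₃,…,f_k}),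
-- the sets T₁, T₂, and the subhypergraph G (vertex set VG, edge set EG).
record Gadget {k n : ℕ} (H : Hypergraph k n) (e f : Subset n) : Set where
  field
    e₁ e₂ f₁ f₂ : Fin n
    S T₁ T₂     : Subset n
    e₁≢e₂   : e₁ ≢ e₂
    e₁∉S    : e₁ ∉ S
    e₂∉S    : e₂ ∉ S
    S-size  : ∣ S ∣ + 2 ≡ k
    e-def   : e ≡ ⁅ e₁ ⁆ ∪ ⁅ e₂ ⁆ ∪ S
    f-def   : f ≡ ⁅ f₁ ⁆ ∪ ⁅ f₂ ⁆ ∪ S
    T₁-e₁   : InNbhd H e₁ T₁
    T₁-f₁   : InNbhd H f₁ T₁
    T₂-e₂   : InNbhd H e₂ T₂
    T₂-f₂   : InNbhd H f₂ T₂
    disj    : AllPairs Disjoint (e ∷ ⁅ f₁ ⁆ ∷ ⁅ f₂ ⁆ ∷ T₁ ∷ T₂ ∷ [])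
    VG      : Subset n
    VG-def  : VG ≡ ⋃ (e ∷ ⁅ f₁ ⁆ ∷ ⁅ f₂ ⁆ ∷ T₁ ∷ T₂ ∷ [])
    EG      : Subset n → Bool
    EG⊆EH   : ∀ s → EG s ≡ true → E H s ≡ true
    EG⊆VG   : ∀ s → EG s ≡ true → s ⊆ VG
    e∈G     : EG e ≡ true
    f∈G     : EG f ≡ true
    e₁T₁∈G  : EG (T₁ ∪ ⁅ e₁ ⁆) ≡ true
    f₁T₁∈G  : EG (T₁ ∪ ⁅ f₁ ⁆) ≡ true
    e₂T₂∈G  : EG (T₂ ∪ ⁅ e₂ ⁆) ≡ true
    f₂T₂∈G  : EG (T₂ ∪ ⁅ f₂ ⁆) ≡ true
open Gadget public

Good : {k n r : ℕ} {H : Hypergraph k n} {e f : Subset n} →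
       Colouring n r → Gadget H e f → Set
Good {r = r} c G =
  Σ (List _) λ M₁ → Σ (List _) λ M₂ →
    IsPerfectMatching (VG G) (EG G) M₁ ×
    IsPerfectMatching (VG G) (EG G) M₂ ×
    ¬ (∀ (i : Fin r) → colourCount c M₁ i ≡ colourCount c M₂ i)

{-# OPTIONS --safe #-}
module Submission where

-- Every pair has codegree above half of C(n, k-2), so the links of {v₁,v₃} and of {v₂,v₄}, two
-- families of (k-2)-sets, share a set S, and e = S ∪ {v₁,v₃}, f = S ∪ {v₂,v₄} are edges. At most
-- |X|·n^(k-2) of the (k-1)-sets meet a vertex set X, so a family C_iC_j(uv) of size at least
-- 3k·n^(k-2) has a member avoiding any X with |X| < 3k. This yields T₁ ∈ C_iC_j(v₁v₂) avoiding
-- S ∪ {v₁,…,v₄} and then T₂ ∈ C_iC_j(v₃v₄) avoiding T₁ ∪ S ∪ {v₁,…,v₄}, a set of at most 2k+1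
-- vertices. The gadget on these 3k vertices has the perfect matchings {T₁∪{v₂}, T₂∪{v₄}, e} and
-- {T₁∪{v₁}, T₂∪{v₃}, f}: in the first only e can have colour C_i, in the second two edges do.

import Algebra.Solver.CommutativeMonoid as CommutativeMonoidSolver
open import Data.Bool using (Bool; true; false; _∧_; _∨_; not; if_then_else_)
open import Data.Bool.Properties using (∧-conicalˡ; ∧-conicalʳ; ∨-conicalˡ; ∨-conicalʳ; ∧-comm; ∧-assoc; T-≡)
open import Data.Fin using (Fin; zero; suc)
open import Data.Fin.Properties using () renaming (_≟_ to _≟ᶠ_)
open import Data.Fin.Subset using (Subset; ⁅_⁆; _∪_; ⊥; ⋃; ∣_∣; _∈_; _∉_; _⊆_)
open import Data.Fin.Subset.Properties
  using ( ∪-identityˡ; ∪-comm; ∩-comm; ∪-commutativeMonoid; _⊆?_; p⊆p∪q; q⊆p∪q; ⊆-trans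
        ; x∈p∩q⁺; x∈p∩q⁻; x∈p∪q⁺; x∈p∪q⁻; ∉⊥; Empty-unique; drop-not-there; x∈⁅y⁆⇒x≡y; x≢y⇒x∉⁅y⁆
        ; ∣p∣≤∣x∷p∣; ∣⊥∣≡0; ∣⁅x⁆∣≡1 )
open import Data.List using (List; []; _∷_; _++_; map)
open import Data.List.Relation.Unary.All as All using (All; []; _∷_)
open import Data.List.Relation.Unary.AllPairs using (AllPairs; []; _∷_)
open import Data.Nat using (ℕ; zero; suc; _+_; _*_; _^_; _∸_; _≤_; _<_; _≡ᵇ_; z≤n; s≤s; z<s; NonZero)
open import Data.Nat.Combinatorics using (_C_; nCk+nC[k+1]≡[n+1]C[k+1])
open import Data.Nat.ListAction using (sum)
open import Data.Nat.Properties
open import Data.Nat.Tactic.RingSolver using (solve-∀)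
open import Data.Product using (Σ; _×_; _,_; proj₁; proj₂)
open import Data.Sum using (inj₁; inj₂; [_,_]′)
open import Data.Vec using ([]; _∷_; lookup; here)
open import Data.Vec.Properties using ([]=⇒lookup)
open import Defs hiding (S; T₁; T₂; VG)
open import Function using (_∘_)
open import Function.Bundles using (Equivalence)
open import Relation.Binary.PropositionalEquality
open import Relation.Nullary using (Dec; yes; no; contradiction)
open import Relation.Nullary.Decidable using (⌊_⌋; toWitness; fromWitness)

variable
  A B   : Set
  m n   : ℕ
  P Q R : A → Bool
  p q r : Subset n
  x y   : Fin n

∧≡true⁻ : ∀ a {b} → a ∧ b ≡ true → a ≡ true × b ≡ true
∧≡true⁻ a a∧b = ∧-conicalˡ a _ a∧b , ∧-conicalʳ a _ a∧b

not≡true⁻ : ∀ {a} → not a ≡ true → a ≡ false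
not≡true⁻ {false} _ = refl

⌊⌋≡true⁻ : ∀ {a? : Dec A} → ⌊ a? ⌋ ≡ true → A
⌊⌋≡true⁻ h = toWitness (Equivalence.from T-≡ h)

≡⇒≡ᵇ≡true : ∀ {m n} → m ≡ n → (m ≡ᵇ n) ≡ true
≡⇒≡ᵇ≡true {m} {n} eq = Equivalence.to T-≡ (≡⇒≡ᵇ m n eq)

m≤n⇒n<m+o⇒0<o : ∀ {m n o} → m ≤ n → n < m + o → 0 < o
m≤n⇒n<m+o⇒0<o {m} {o = zero}  m≤n n<m+0 =
  contradiction (<-≤-trans n<m+0 (subst (_≤ _) (sym (+-identityʳ m)) m≤n)) (<-irrefl refl)
m≤n⇒n<m+o⇒0<o {o = suc o} _ _ = z<s

m<2n⇒m<2o⇒m<n+o : ∀ {m n o} → m < 2 * n → m < 2 * o → m < n + o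
m<2n⇒m<2o⇒m<n+o {m} {n} {o} m<2n m<2o with ≤-total n o
... | inj₁ n≤o = <-≤-trans m<2n (subst (_≤ n + o) (cong (n +_) (sym (+-identityʳ n))) (+-monoʳ-≤ n n≤o))
... | inj₂ o≤n = <-≤-trans m<2o (subst (_≤ n + o) (cong (o +_) (sym (+-identityʳ o))) (+-monoˡ-≤ o o≤n))

-- Counting

count : (A → Bool) → List A → ℕ
count P []       = 0
count P (x ∷ xs) = if P x then suc (count P xs) else count P xs

count-unique : (P : A → Bool) (g : List A → ℕ) → g [] ≡ 0 →
               (∀ x xs → g (x ∷ xs) ≡ (if P x then suc (g xs) else g xs)) →
               ∀ xs → g xs ≡ count P xs
count-unique P g g[] g∷ []       = g[]
count-unique P g g[] g∷ (x ∷ xs) rewrite g∷ x xs | count-unique P g g[] g∷ xs = refl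

-- countSubsets counts with a local helper of Defs that cannot be named; abstracting over
-- allSubsets n lets that helper be matched against count through its defining equations.
countSubsets≡count : (P : Subset n → Bool) → countSubsets P ≡ count P (allSubsets n)
countSubsets≡count {n} P with allSubsets n | count-unique P _ refl (λ _ _ → refl)
... | xs | g≡count = g≡count xs

count-false : ∀ (xs : List A) → count (λ _ → false) xs ≡ 0
count-false []       = refl
count-false (x ∷ xs) = count-false xs

count-++ : ∀ xs ys → count P (xs ++ ys) ≡ count P xs + count P ys
count-++         []       ys = refl
count-++ {P = P} (x ∷ xs) ys with P x
... | true  = cong suc (count-++ xs ys)
... | false = count-++ xs ys

count-map : (f : B → A) → ∀ xs → count P (map f xs) ≡ count (P ∘ f) xs
count-map         f []       = refl
count-map {P = P} f (x ∷ xs) with P (f x)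
... | true  = cong suc (count-map f xs)
... | false = count-map f xs

count-cong : (∀ x → P x ≡ Q x) → ∀ xs → count P xs ≡ count Q xs
count-cong         P≡Q []       = refl
count-cong {Q = Q} P≡Q (x ∷ xs) rewrite P≡Q x with Q x
... | true  = cong suc (count-cong P≡Q xs)
... | false = count-cong P≡Q xs

count-mono : (∀ x → P x ≡ true → Q x ≡ true) → ∀ xs → count P xs ≤ count Q xs
count-mono                 P⇒Q []       = z≤n
count-mono {P = P} {Q = Q} P⇒Q (x ∷ xs) with P x in Px
... | true rewrite P⇒Q x Px = s≤s (count-mono P⇒Q xs)
... | false with Q x
...   | true  = m≤n⇒m≤1+n (count-mono P⇒Q xs)
...   | false = count-mono P⇒Q xs

count-split : ∀ (Q : A → Bool) xs →
              count P xs ≡ count (λ x → P x ∧ Q x) xs + count (λ x → P x ∧ not (Q x)) xs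
count-split         Q []       = refl
count-split {P = P} Q (x ∷ xs) with P x | Q x
... | true  | true  = cong suc (count-split Q xs)
... | true  | false = trans (cong suc (count-split Q xs)) (sym (+-suc _ _))
... | false | _     = count-split Q xs

count-∨ : ∀ xs → count P xs + count Q xs ≡ count (λ x → P x ∨ Q x) xs + count (λ x → P x ∧ Q x) xs
count-∨                 []       = refl
count-∨ {P = P} {Q = Q} (x ∷ xs) with P x | Q x
... | true  | true  = cong suc (trans (+-suc _ _) (trans (cong suc (count-∨ xs)) (sym (+-suc _ _))))
... | true  | false = cong suc (count-∨ xs)
... | false | true  = trans (+-suc _ _) (cong suc (count-∨ xs))
... | false | false = count-∨ xs

count-witness : ∀ xs → 0 < count P xs → Σ A λ x → P x ≡ true
count-witness {P = P} (x ∷ xs) pos with P x in Px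
... | true  = x , Px
... | false = count-witness xs pos

count-common : (∀ x → P x ≡ true → R x ≡ true) → (∀ x → Q x ≡ true → R x ≡ true) →
               ∀ xs → count R xs < count P xs + count Q xs → Σ A λ x → P x ≡ true × Q x ≡ true
count-common {P = P} {R = R} {Q = Q} P⇒R Q⇒R xs R<P+Q =
  let x , Px∧Qx = count-witness xs 0<count[P∧Q] in x , ∧≡true⁻ (P x) Px∧Qx
  where
  P∨Q⇒R : ∀ x → (P x ∨ Q x) ≡ true → R x ≡ true
  P∨Q⇒R x P∨Qx with P x in Px
  ... | true  = P⇒R x Px
  ... | false = Q⇒R x P∨Qx
  0<count[P∧Q] : 0 < count (λ x → P x ∧ Q x) xs
  0<count[P∧Q] = m≤n⇒n<m+o⇒0<o (count-mono {Q = R} P∨Q⇒R xs) (subst (count R xs <_) (count-∨ xs) R<P+Q)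

count-allSubsets-suc : ∀ n (P : Subset (suc n) → Bool) →
  count P (allSubsets (suc n)) ≡ count (P ∘ (false ∷_)) (allSubsets n) + count (P ∘ (true ∷_)) (allSubsets n)
count-allSubsets-suc n P =
  trans (count-++ (map (false ∷_) (allSubsets n)) _)
        (cong₂ _+_ (count-map (false ∷_) (allSubsets n)) (count-map (true ∷_) (allSubsets n)))

count-ofSize : ∀ n m → count (λ s → ∣ s ∣ ≡ᵇ m) (allSubsets n) ≡ n C m
count-ofSize zero    zero    = refl
count-ofSize zero    (suc m) = refl
count-ofSize (suc n) zero    =
  trans (count-allSubsets-suc n (λ s → ∣ s ∣ ≡ᵇ 0))
        (cong₂ _+_ (count-ofSize n 0) (count-false (allSubsets n)))
count-ofSize (suc n) (suc m) = begin
  count (λ s → ∣ s ∣ ≡ᵇ suc m) (allSubsets (suc n))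
    ≡⟨ count-allSubsets-suc n (λ s → ∣ s ∣ ≡ᵇ suc m) ⟩
  count (λ s → ∣ s ∣ ≡ᵇ suc m) (allSubsets n) + count (λ s → ∣ s ∣ ≡ᵇ m) (allSubsets n)
    ≡⟨ cong₂ _+_ (count-ofSize n (suc m)) (count-ofSize n m) ⟩
  n C suc m + n C m  ≡⟨ +-comm (n C suc m) (n C m) ⟩
  n C m + n C suc m  ≡⟨ nCk+nC[k+1]≡[n+1]C[k+1] n m ⟩
  suc n C suc m      ∎
  where open ≡-Reasoning

nCk≤n^k : ∀ n k → n C k ≤ n ^ k
nCk≤n^k zero    zero    = ≤-refl
nCk≤n^k zero    (suc k) = z≤n
nCk≤n^k (suc n) zero    = ≤-refl
nCk≤n^k (suc n) (suc k) = begin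
  suc n C suc k              ≡⟨ nCk+nC[k+1]≡[n+1]C[k+1] n k ⟨
  n C k + n C suc k          ≤⟨ +-mono-≤ (nCk≤n^k n k) (nCk≤n^k n (suc k)) ⟩
  n ^ k + n * n ^ k          ≤⟨ +-mono-≤ n^k≤[1+n]^k (*-monoʳ-≤ n n^k≤[1+n]^k) ⟩
  suc n ^ k + n * suc n ^ k  ∎
  where
  open ≤-Reasoning
  n^k≤[1+n]^k : n ^ k ≤ suc n ^ k
  n^k≤[1+n]^k = ^-monoˡ-≤ k (n≤1+n n)

meets : Subset n → Subset n → Bool
meets []      []      = false
meets (a ∷ p) (b ∷ q) = (a ∧ b) ∨ meets p q

count-emptyMeeting : ∀ n (X : Subset n) → count (λ s → (∣ s ∣ ≡ᵇ 0) ∧ meets s X) (allSubsets n) ≡ 0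
count-emptyMeeting zero    []      = refl
count-emptyMeeting (suc n) (a ∷ X) =
  trans (count-allSubsets-suc n (λ s → (∣ s ∣ ≡ᵇ 0) ∧ meets s (a ∷ X)))
        (cong₂ _+_ (count-emptyMeeting n X) (count-false (allSubsets n)))

count-meeting : ∀ n m (X : Subset n) →
                count (λ s → (∣ s ∣ ≡ᵇ suc m) ∧ meets s X) (allSubsets n) ≤ ∣ X ∣ * n ^ m
count-meeting zero    m       []          = z≤n
count-meeting (suc n) m       (true ∷ X)  = begin
  count _ (allSubsets (suc n))
    ≡⟨ count-allSubsets-suc n (λ s → (∣ s ∣ ≡ᵇ suc m) ∧ meets s (true ∷ X)) ⟩
  count (λ s → (∣ s ∣ ≡ᵇ suc m) ∧ meets s X) (allSubsets n) + count (λ s → (∣ s ∣ ≡ᵇ m) ∧ true) (allSubsets n)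
    ≤⟨ +-mono-≤ (count-meeting n m X) (count-mono (λ s → ∧-conicalˡ _ _) (allSubsets n)) ⟩
  ∣ X ∣ * n ^ m + count (λ s → ∣ s ∣ ≡ᵇ m) (allSubsets n)  ≡⟨ cong (∣ X ∣ * n ^ m +_) (count-ofSize n m) ⟩
  ∣ X ∣ * n ^ m + n C m    ≤⟨ +-monoʳ-≤ (∣ X ∣ * n ^ m) (nCk≤n^k n m) ⟩
  ∣ X ∣ * n ^ m + n ^ m    ≡⟨ +-comm (∣ X ∣ * n ^ m) (n ^ m) ⟩
  suc ∣ X ∣ * n ^ m        ≤⟨ *-monoʳ-≤ (suc ∣ X ∣) (^-monoˡ-≤ m (n≤1+n n)) ⟩
  suc ∣ X ∣ * suc n ^ m    ∎
  where open ≤-Reasoning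
count-meeting (suc n) zero    (false ∷ X) = begin
  count _ (allSubsets (suc n))
    ≡⟨ count-allSubsets-suc n (λ s → (∣ s ∣ ≡ᵇ 1) ∧ meets s (false ∷ X)) ⟩
  count (λ s → (∣ s ∣ ≡ᵇ 1) ∧ meets s X) (allSubsets n) + count (λ s → (∣ s ∣ ≡ᵇ 0) ∧ meets s X) (allSubsets n)
    ≤⟨ +-mono-≤ (count-meeting n zero X) (≤-reflexive (count-emptyMeeting n X)) ⟩
  ∣ X ∣ * 1 + 0  ≡⟨ +-identityʳ _ ⟩
  ∣ X ∣ * 1      ∎
  where open ≤-Reasoning
count-meeting (suc n) (suc m) (false ∷ X) = begin
  count _ (allSubsets (suc n))
    ≡⟨ count-allSubsets-suc n (λ s → (∣ s ∣ ≡ᵇ suc (suc m)) ∧ meets s (false ∷ X)) ⟩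
  count (λ s → (∣ s ∣ ≡ᵇ suc (suc m)) ∧ meets s X) (allSubsets n)
    + count (λ s → (∣ s ∣ ≡ᵇ suc m) ∧ meets s X) (allSubsets n)
    ≤⟨ +-mono-≤ (count-meeting n (suc m) X) (count-meeting n m X) ⟩
  ∣ X ∣ * (n * n ^ m) + ∣ X ∣ * n ^ m  ≡⟨ *-distribˡ-+ ∣ X ∣ (n * n ^ m) (n ^ m) ⟨
  ∣ X ∣ * (n * n ^ m + n ^ m)          ≡⟨ cong (∣ X ∣ *_) (+-comm (n * n ^ m) (n ^ m)) ⟩
  ∣ X ∣ * (suc n * n ^ m)              ≤⟨ *-monoʳ-≤ ∣ X ∣ (*-monoʳ-≤ (suc n) (^-monoˡ-≤ m (n≤1+n n))) ⟩
  ∣ X ∣ * (suc n * suc n ^ m)          ∎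
  where open ≤-Reasoning

count-containing : ∀ (u : Fin n) (R : Subset n → Bool) →
  count (λ s → lookup s u ∧ R s) (allSubsets n) ≡ count (λ s → not (lookup s u) ∧ R (⁅ u ⁆ ∪ s)) (allSubsets n)
count-containing {suc n} zero R = begin
  count (λ s → lookup s zero ∧ R s) (allSubsets (suc n))
    ≡⟨ count-allSubsets-suc n (λ s → lookup s zero ∧ R s) ⟩
  count (λ _ → false) (allSubsets n) + count (R ∘ (true ∷_)) (allSubsets n)
    ≡⟨ +-comm (count (λ _ → false) (allSubsets n)) _ ⟩
  count (R ∘ (true ∷_)) (allSubsets n) + count (λ _ → false) (allSubsets n)
    ≡⟨ cong (_+ _) (count-cong (λ s → cong (R ∘ (true ∷_)) (sym (∪-identityˡ s))) (allSubsets n)) ⟩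
  count (λ s → R (true ∷ (⊥ ∪ s))) (allSubsets n) + count (λ _ → false) (allSubsets n)
    ≡⟨ count-allSubsets-suc n (λ s → not (lookup s zero) ∧ R (⁅ zero ⁆ ∪ s)) ⟨
  count (λ s → not (lookup s zero) ∧ R (⁅ zero ⁆ ∪ s)) (allSubsets (suc n)) ∎
  where open ≡-Reasoning
count-containing {suc n} (suc u) R =
  trans (count-allSubsets-suc n (λ s → lookup s (suc u) ∧ R s))
        (trans (cong₂ _+_ (count-containing u (R ∘ (false ∷_))) (count-containing u (R ∘ (true ∷_))))
               (sym (count-allSubsets-suc n (λ s → not (lookup s (suc u)) ∧ R (⁅ suc u ⁆ ∪ s)))))

-- Subsets of Fin n

not-lookup⇒∉ : not (lookup p x) ≡ true → x ∉ p
not-lookup⇒∉ x∉p x∈p = contradiction (trans (cong not (sym ([]=⇒lookup x∈p))) x∉p) λ ()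

lookup-⁅⁆∪ : ∀ (p : Subset n) → x ≢ y → lookup (⁅ y ⁆ ∪ p) x ≡ lookup p x
lookup-⁅⁆∪ {x = zero}  {zero}  p       x≢y = contradiction refl x≢y
lookup-⁅⁆∪ {x = zero}  {suc y} (b ∷ p) x≢y = refl
lookup-⁅⁆∪ {x = suc x} {zero}  (b ∷ p) x≢y = cong (λ q → lookup q x) (∪-identityˡ p)
lookup-⁅⁆∪ {x = suc x} {suc y} (b ∷ p) x≢y = lookup-⁅⁆∪ p (x≢y ∘ cong suc)

∣⁅x⁆∪p∣≡1+∣p∣ : x ∉ p → ∣ ⁅ x ⁆ ∪ p ∣ ≡ suc ∣ p ∣
∣⁅x⁆∪p∣≡1+∣p∣ {x = zero}  {p = false ∷ p} x∉p = cong (suc ∘ ∣_∣) (∪-identityˡ p)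
∣⁅x⁆∪p∣≡1+∣p∣ {x = zero}  {p = true ∷ p}  x∉p = contradiction here x∉p
∣⁅x⁆∪p∣≡1+∣p∣ {x = suc x} {p = false ∷ p} x∉p = ∣⁅x⁆∪p∣≡1+∣p∣ (drop-not-there x∉p)
∣⁅x⁆∪p∣≡1+∣p∣ {x = suc x} {p = true ∷ p}  x∉p = cong suc (∣⁅x⁆∪p∣≡1+∣p∣ (drop-not-there x∉p))

∣p∪q∣≤∣p∣+∣q∣ : ∀ (p q : Subset n) → ∣ p ∪ q ∣ ≤ ∣ p ∣ + ∣ q ∣
∣p∪q∣≤∣p∣+∣q∣ []          []          = z≤n
∣p∪q∣≤∣p∣+∣q∣ (true ∷ p)  (b ∷ q)     = s≤s (≤-trans (∣p∪q∣≤∣p∣+∣q∣ p q) (+-monoʳ-≤ ∣ p ∣ (∣p∣≤∣x∷p∣ b q)))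
∣p∪q∣≤∣p∣+∣q∣ (false ∷ p) (true ∷ q)  = ≤-trans (s≤s (∣p∪q∣≤∣p∣+∣q∣ p q)) (≤-reflexive (sym (+-suc ∣ p ∣ ∣ q ∣)))
∣p∪q∣≤∣p∣+∣q∣ (false ∷ p) (false ∷ q) = ∣p∪q∣≤∣p∣+∣q∣ p q

∣⋃ps∣≤sum : ∀ (ps : List (Subset n)) → ∣ ⋃ ps ∣ ≤ sum (map ∣_∣ ps)
∣⋃ps∣≤sum {n} []       = ≤-reflexive (∣⊥∣≡0 n)
∣⋃ps∣≤sum     (p ∷ ps) = ≤-trans (∣p∪q∣≤∣p∣+∣q∣ p (⋃ ps)) (+-monoʳ-≤ ∣ p ∣ (∣⋃ps∣≤sum ps))

⊆-⋃ : ∀ (ps : List (Subset n)) → All (_⊆ ⋃ ps) ps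
⊆-⋃ []       = []
⊆-⋃ (p ∷ ps) = p⊆p∪q (⋃ ps) ∷ All.map ⊆p∪⋃ps (⊆-⋃ ps)
  where
  ⊆p∪⋃ps : q ⊆ ⋃ ps → q ⊆ p ∪ ⋃ ps
  ⊆p∪⋃ps q⊆⋃ps = ⊆-trans q⊆⋃ps (q⊆p∪q p (⋃ ps))

Disjoint⇒∉ : Disjoint p q → x ∈ p → x ∉ q
Disjoint⇒∉ p∩q≡⊥ x∈p x∈q = ∉⊥ (subst (_ ∈_) p∩q≡⊥ (x∈p∩q⁺ (x∈p , x∈q)))

∉⇒Disjoint : (∀ {x} → x ∈ p → x ∉ q) → Disjoint p q
∉⇒Disjoint {p = p} {q = q} p∌q =
  Empty-unique λ (x , x∈p∩q) → let x∈p , x∈q = x∈p∩q⁻ p q x∈p∩q in p∌q x∈p x∈q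

Disjoint-sym : Disjoint p q → Disjoint q p
Disjoint-sym {p = p} {q = q} p∩q≡⊥ = trans (∩-comm q p) p∩q≡⊥

Disjoint-∪ˡ : Disjoint p r → Disjoint q r → Disjoint (p ∪ q) r
Disjoint-∪ˡ {p = p} {q = q} p#r q#r =
  ∉⇒Disjoint λ x∈p∪q → [ Disjoint⇒∉ p#r , Disjoint⇒∉ q#r ]′ (x∈p∪q⁻ p q x∈p∪q)

Disjoint-∪ʳ : Disjoint p q → Disjoint p r → Disjoint p (q ∪ r)
Disjoint-∪ʳ p#q p#r = Disjoint-sym (Disjoint-∪ˡ (Disjoint-sym p#q) (Disjoint-sym p#r))

Disjoint-∪ʳ⁻ : Disjoint p (q ∪ r) → Disjoint p q × Disjoint p r
Disjoint-∪ʳ⁻ p#q∪r = ∉⇒Disjoint (λ x∈p x∈q → Disjoint⇒∉ p#q∪r x∈p (x∈p∪q⁺ (inj₁ x∈q)))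
                   , ∉⇒Disjoint (λ x∈p x∈r → Disjoint⇒∉ p#q∪r x∈p (x∈p∪q⁺ (inj₂ x∈r)))

Disjoint-⋃⁻ : ∀ qs → Disjoint p (⋃ qs) → All (Disjoint p) qs
Disjoint-⋃⁻ []       _       = []
Disjoint-⋃⁻ (q ∷ qs) p#q∪qs = let p#q , p#qs = Disjoint-∪ʳ⁻ p#q∪qs in p#q ∷ Disjoint-⋃⁻ qs p#qs

∉⇒Disjoint-⁅⁆ : x ∉ p → Disjoint p ⁅ x ⁆
∉⇒Disjoint-⁅⁆ {x = x} {p = p} x∉p = ∉⇒Disjoint λ y∈p y∈⁅x⁆ → x∉p (subst (_∈ p) (x∈⁅y⁆⇒x≡y x y∈⁅x⁆) y∈p)

≢⇒Disjoint-⁅⁆ : x ≢ y → Disjoint ⁅ x ⁆ ⁅ y ⁆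
≢⇒Disjoint-⁅⁆ x≢y = ∉⇒Disjoint-⁅⁆ (x≢y⇒x∉⁅y⁆ (x≢y ∘ sym))

meets≡false⇒Disjoint : ∀ (p q : Subset n) → meets p q ≡ false → Disjoint p q
meets≡false⇒Disjoint []      []      _ = refl
meets≡false⇒Disjoint (a ∷ p) (b ∷ q) h =
  cong₂ _∷_ (∨-conicalˡ _ _ h) (meets≡false⇒Disjoint p q (∨-conicalʳ _ _ h))

pairUp-Disjoint : ∀ {a b c d e : Subset n} → AllPairs Disjoint (a ∷ b ∷ c ∷ d ∷ e ∷ []) →
                  AllPairs Disjoint (d ∪ b ∷ e ∪ c ∷ a ∷ [])
pairUp-Disjoint
  ((a#b ∷ a#c ∷ a#d ∷ a#e ∷ []) ∷ (b#c ∷ b#d ∷ b#e ∷ []) ∷ (c#d ∷ c#e ∷ []) ∷ (d#e ∷ []) ∷ [] ∷ []) =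
    ( Disjoint-∪ˡ (Disjoint-∪ʳ d#e (Disjoint-sym c#d)) (Disjoint-∪ʳ b#e b#c)
    ∷ Disjoint-∪ˡ (Disjoint-sym a#d) (Disjoint-sym a#b) ∷ [])
  ∷ (Disjoint-∪ˡ (Disjoint-sym a#e) (Disjoint-sym a#c) ∷ [])
  ∷ [] ∷ []

⋃-pairUp : ∀ (a b c d e : Subset n) → ⋃ (d ∪ b ∷ e ∪ c ∷ a ∷ []) ≡ ⋃ (a ∷ b ∷ c ∷ d ∷ e ∷ [])
⋃-pairUp {n} a b c d e =
  prove 5 ((x₄ ⊕ x₂) ⊕ (x₅ ⊕ x₃) ⊕ x₁ ⊕ id) (x₁ ⊕ x₂ ⊕ x₃ ⊕ x₄ ⊕ x₅ ⊕ id) (a ∷ b ∷ c ∷ d ∷ e ∷ [])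
  where
  open CommutativeMonoidSolver (∪-commutativeMonoid n)
  x₁ x₂ x₃ x₄ x₅ : Expr 5
  x₁ = var zero
  x₂ = var (suc zero)
  x₃ = var (suc (suc zero))
  x₄ = var (suc (suc (suc zero)))
  x₅ = var (suc (suc (suc (suc zero))))

regroup-Disjoint : ∀ {T₂ T₁ S x₁ x₂ x₃ x₄ : Subset n} →
  AllPairs Disjoint (T₂ ∷ T₁ ∷ S ∷ x₁ ∷ x₂ ∷ x₃ ∷ x₄ ∷ []) →
  AllPairs Disjoint (x₁ ∪ x₃ ∪ S ∷ x₂ ∷ x₄ ∷ T₁ ∷ T₂ ∷ []) ×
  AllPairs Disjoint (x₂ ∪ x₄ ∪ S ∷ x₁ ∷ x₃ ∷ T₁ ∷ T₂ ∷ [])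
regroup-Disjoint
  ( (T₂T₁ ∷ T₂S ∷ T₂x₁ ∷ T₂x₂ ∷ T₂x₃ ∷ T₂x₄ ∷ []) ∷ (T₁S ∷ T₁x₁ ∷ T₁x₂ ∷ T₁x₃ ∷ T₁x₄ ∷ [])
  ∷ (Sx₁ ∷ Sx₂ ∷ Sx₃ ∷ Sx₄ ∷ []) ∷ (x₁x₂ ∷ x₁x₃ ∷ x₁x₄ ∷ []) ∷ (x₂x₃ ∷ x₂x₄ ∷ []) ∷ (x₃x₄ ∷ []) ∷ [] ∷ []) =
    ( ( ∪³ x₁x₂ (swap x₂x₃) Sx₂ ∷ ∪³ x₁x₄ x₃x₄ Sx₄
      ∷ ∪³ (swap T₁x₁) (swap T₁x₃) (swap T₁S) ∷ ∪³ (swap T₂x₁) (swap T₂x₃) (swap T₂S) ∷ [])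
    ∷ (x₂x₄ ∷ swap T₁x₂ ∷ swap T₂x₂ ∷ []) ∷ (swap T₁x₄ ∷ swap T₂x₄ ∷ []) ∷ (swap T₂T₁ ∷ []) ∷ [] ∷ [])
  , ( ( ∪³ (swap x₁x₂) (swap x₁x₄) Sx₁ ∷ ∪³ x₂x₃ (swap x₃x₄) Sx₃
      ∷ ∪³ (swap T₁x₂) (swap T₁x₄) (swap T₁S) ∷ ∪³ (swap T₂x₂) (swap T₂x₄) (swap T₂S) ∷ [])
    ∷ (x₁x₃ ∷ swap T₁x₁ ∷ swap T₂x₁ ∷ []) ∷ (swap T₁x₃ ∷ swap T₂x₃ ∷ []) ∷ (swap T₂T₁ ∷ []) ∷ [] ∷ [])
  where
  swap : Disjoint p q → Disjoint q p
  swap = Disjoint-sym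
  ∪³ : ∀ {a b c d : Subset n} → Disjoint a d → Disjoint b d → Disjoint c d → Disjoint (a ∪ b ∪ c) d
  ∪³ a#d b#d c#d = Disjoint-∪ˡ a#d (Disjoint-∪ˡ b#d c#d)

-- Links and C_iC_j families

record InLink {k n : ℕ} (H : Hypergraph k n) (u v : Fin n) (S : Subset n) : Set where
  field
    u∉S   : u ∉ S
    v∉S   : v ∉ S
    uvS∈H : E H (⁅ u ⁆ ∪ ⁅ v ⁆ ∪ S) ≡ true

-- The conjuncts are in the order in which count-containing produces them from codeg.
inLinkᵇ : ∀ {k n} → Hypergraph k n → Fin n → Fin n → Subset n → Bool
inLinkᵇ H u v S = not (lookup S v) ∧ not (lookup S u) ∧ E H (⁅ u ⁆ ∪ ⁅ v ⁆ ∪ S)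

module _ {k n : ℕ} (H : Hypergraph k n) where

  inLinkᵇ⇒InLink : ∀ {u v S} → inLinkᵇ H u v S ≡ true → InLink H u v S
  inLinkᵇ⇒InLink {u} {v} {S} uvS =
    let v∉S , uvS′  = ∧≡true⁻ (not (lookup S v)) uvS
        u∉S , uvS∈H = ∧≡true⁻ (not (lookup S u)) uvS′
    in record { u∉S = not-lookup⇒∉ u∉S ; v∉S = not-lookup⇒∉ v∉S ; uvS∈H = uvS∈H }

  InLink-size : ∀ {u v S} → u ≢ v → InLink H u v S → suc (suc ∣ S ∣) ≡ k
  InLink-size {u} {v} {S} u≢v record { u∉S = u∉S ; v∉S = v∉S ; uvS∈H = uvS∈H } = begin
    suc (suc ∣ S ∣)        ≡⟨ cong suc (∣⁅x⁆∪p∣≡1+∣p∣ v∉S) ⟨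
    suc ∣ ⁅ v ⁆ ∪ S ∣      ≡⟨ ∣⁅x⁆∪p∣≡1+∣p∣ u∉⁅v⁆∪S ⟨
    ∣ ⁅ u ⁆ ∪ ⁅ v ⁆ ∪ S ∣  ≡⟨ uniform H _ uvS∈H ⟩
    k                      ∎
    where
    open ≡-Reasoning
    u∉⁅v⁆∪S : u ∉ ⁅ v ⁆ ∪ S
    u∉⁅v⁆∪S u∈⁅v⁆∪S = [ u≢v ∘ x∈⁅y⁆⇒x≡y v , u∉S ]′ (x∈p∪q⁻ ⁅ v ⁆ S u∈⁅v⁆∪S)

  InNbhd-size : ∀ {u T} → InNbhd H u T → suc ∣ T ∣ ≡ k
  InNbhd-size {u} {T} (u∉T , Tu∈H) =
    trans (sym (∣⁅x⁆∪p∣≡1+∣p∣ u∉T)) (trans (cong ∣_∣ (∪-comm ⁅ u ⁆ T)) (uniform H _ Tu∈H))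

  codeg≡count-inLink : ∀ {u v} → u ≢ v → codeg H u v ≡ count (inLinkᵇ H u v) (allSubsets n)
  codeg≡count-inLink {u} {v} u≢v = begin
    codeg H u v
      ≡⟨ countSubsets≡count (λ s → E H s ∧ lookup s u ∧ lookup s v) ⟩
    count (λ s → E H s ∧ lookup s u ∧ lookup s v) (allSubsets n)
      ≡⟨ count-cong (λ s → trans (∧-comm (E H s) _) (∧-assoc (lookup s u) _ _)) (allSubsets n) ⟩
    count (λ s → lookup s u ∧ lookup s v ∧ E H s) (allSubsets n)
      ≡⟨ count-containing u (λ s → lookup s v ∧ E H s) ⟩
    count (λ s → not (lookup s u) ∧ lookup (⁅ u ⁆ ∪ s) v ∧ E H (⁅ u ⁆ ∪ s)) (allSubsets n)
      ≡⟨ count-cong (λ s → trans (cong (λ b → not (lookup s u) ∧ b ∧ E H (⁅ u ⁆ ∪ s)) (lookup-⁅⁆∪ s (u≢v ∘ sym)))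
                                  (∧-swap (not (lookup s u)) (lookup s v) _))
                    (allSubsets n) ⟩
    count (λ s → lookup s v ∧ not (lookup s u) ∧ E H (⁅ u ⁆ ∪ s)) (allSubsets n)
      ≡⟨ count-containing v (λ s → not (lookup s u) ∧ E H (⁅ u ⁆ ∪ s)) ⟩
    count (λ s → not (lookup s v) ∧ not (lookup (⁅ v ⁆ ∪ s) u) ∧ E H (⁅ u ⁆ ∪ ⁅ v ⁆ ∪ s)) (allSubsets n)
      ≡⟨ count-cong (λ s → cong (λ b → not (lookup s v) ∧ not b ∧ E H (⁅ u ⁆ ∪ ⁅ v ⁆ ∪ s)) (lookup-⁅⁆∪ s u≢v))
                    (allSubsets n) ⟩
    count (inLinkᵇ H u v) (allSubsets n)
      ∎
    where
    open ≡-Reasoning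
    ∧-swap : ∀ a b c → a ∧ b ∧ c ≡ b ∧ a ∧ c
    ∧-swap a b c = trans (sym (∧-assoc a b c)) (trans (cong (_∧ c) (∧-comm a b)) (∧-assoc b a c))

common-link : ∀ {m n} (H : Hypergraph (2 + m) n) {u v u′ v′ : Fin n} → u ≢ v → u′ ≢ v′ →
              n C m < 2 * codeg H u v → n C m < 2 * codeg H u′ v′ →
              Σ (Subset n) λ S → InLink H u v S × InLink H u′ v′ S
common-link {m} {n} H {u} {v} {u′} {v′} u≢v u′≢v′ dense dense′ =
  let S , uvS , u′v′S = count-common (link⇒size u≢v) (link⇒size u′≢v′) (allSubsets n) nCm<links
  in S , inLinkᵇ⇒InLink H {u} {v} {S} uvS , inLinkᵇ⇒InLink H {u′} {v′} {S} u′v′S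
  where
  link⇒size : ∀ {x y} → x ≢ y → ∀ S → inLinkᵇ H x y S ≡ true → (∣ S ∣ ≡ᵇ m) ≡ true
  link⇒size {x} {y} x≢y S xyS =
    ≡⇒≡ᵇ≡true (suc-injective (suc-injective (InLink-size H x≢y (inLinkᵇ⇒InLink H {x} {y} {S} xyS))))
  nCm<links : count (λ S → ∣ S ∣ ≡ᵇ m) (allSubsets n)
            < count (inLinkᵇ H u v) (allSubsets n) + count (inLinkᵇ H u′ v′) (allSubsets n)
  nCm<links rewrite count-ofSize n m | sym (codeg≡count-inLink H u≢v) | sym (codeg≡count-inLink H u′≢v′) =
    m<2n⇒m<2o⇒m<n+o {n = codeg H u v} {o = codeg H u′ v′} dense dense′

record InCiCj {k n r : ℕ} (H : Hypergraph k n) (c : Colouring n r) (i j : Fin r) (u v : Fin n) (T : Subset n)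
              : Set where
  field
    T∈N[u]   : InNbhd H u T
    T∈N[v]   : InNbhd H v T
    colour-u : c (T ∪ ⁅ u ⁆) ≡ i
    colour-v : c (T ∪ ⁅ v ⁆) ≡ j

-- Literally the predicate counted by CiCj, so CiCj H c i j u v unfolds to countSubsets (inCiCjᵇ H c i j u v).
inCiCjᵇ : ∀ {k n r} → Hypergraph k n → Colouring n r → Fin r → Fin r → Fin n → Fin n → Subset n → Bool
inCiCjᵇ H c i j u v T =
  not (lookup T u) ∧ not (lookup T v) ∧
  E H (T ∪ ⁅ u ⁆) ∧ E H (T ∪ ⁅ v ⁆) ∧
  ⌊ c (T ∪ ⁅ u ⁆) ≟ᶠ i ⌋ ∧ ⌊ c (T ∪ ⁅ v ⁆) ≟ᶠ j ⌋

inCiCjᵇ⇒InCiCj : ∀ {k n r} {H : Hypergraph k n} {c : Colouring n r} {i j u v T} →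
                 inCiCjᵇ H c i j u v T ≡ true → InCiCj H c i j u v T
inCiCjᵇ⇒InCiCj {H = H} {c} {i} {j} {u} {v} {T} T∈C =
  let u∉T  , T∈C₁ = ∧≡true⁻ (not (lookup T u)) T∈C
      v∉T  , T∈C₂ = ∧≡true⁻ (not (lookup T v)) T∈C₁
      Tu∈H , T∈C₃ = ∧≡true⁻ (E H (T ∪ ⁅ u ⁆)) T∈C₂
      Tv∈H , T∈C₄ = ∧≡true⁻ (E H (T ∪ ⁅ v ⁆)) T∈C₃
      cu≡i , cv≡j = ∧≡true⁻ ⌊ c (T ∪ ⁅ u ⁆) ≟ᶠ i ⌋ T∈C₄
  in record { T∈N[u]   = not-lookup⇒∉ u∉T , Tu∈H
            ; T∈N[v]   = not-lookup⇒∉ v∉T , Tv∈H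
            ; colour-u = ⌊⌋≡true⁻ cu≡i
            ; colour-v = ⌊⌋≡true⁻ cv≡j }

CiCj-avoiding : ∀ {m n r} (H : Hypergraph (2 + m) n) (c : Colouring n r) {i j u v} (D : ℕ) .{{_ : NonZero n}}
                (X : Subset n) → ∣ X ∣ < D → D * n ^ m ≤ CiCj H c i j u v →
                Σ (Subset n) λ T → InCiCj H c i j u v T × Disjoint T X
CiCj-avoiding {m} {n} H c {i} {j} {u} {v} D X ∣X∣<D dense =
  let T , T∈C∖X = count-witness (allSubsets n) 0<count-avoiding
      T∈C , T∌X = ∧≡true⁻ (inC T) T∈C∖X
  in T , inC⇒InCiCj {T} T∈C , meets≡false⇒Disjoint T X (not≡true⁻ T∌X)
  where
  inC : Subset n → Bool
  inC = inCiCjᵇ H c i j u v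
  inC⇒InCiCj : ∀ {T} → inC T ≡ true → InCiCj H c i j u v T
  inC⇒InCiCj = inCiCjᵇ⇒InCiCj
  meeting≤ : count (λ T → inC T ∧ meets T X) (allSubsets n) ≤ ∣ X ∣ * n ^ m
  meeting≤ = ≤-trans (count-mono inC∧meets⇒sized (allSubsets n)) (count-meeting n m X)
    where
    inC∧meets⇒sized : ∀ T → inC T ∧ meets T X ≡ true → (∣ T ∣ ≡ᵇ suc m) ∧ meets T X ≡ true
    inC∧meets⇒sized T h = let T∈C , TX = ∧≡true⁻ (inC T) h in
      cong₂ _∧_ (≡⇒≡ᵇ≡true (suc-injective (InNbhd-size H (InCiCj.T∈N[u] (inC⇒InCiCj {T} T∈C))))) TX
  <meeting+avoiding : ∣ X ∣ * n ^ m < count (λ T → inC T ∧ meets T X) (allSubsets n)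
                                   + count (λ T → inC T ∧ not (meets T X)) (allSubsets n)
  <meeting+avoiding = begin-strict
    ∣ X ∣ * n ^ m           <⟨ *-monoˡ-< (n ^ m) {{m^n≢0 n m}} ∣X∣<D ⟩
    D * n ^ m               ≤⟨ dense ⟩
    CiCj H c i j u v        ≡⟨ countSubsets≡count inC ⟩
    count inC (allSubsets n) ≡⟨ count-split (λ T → meets T X) (allSubsets n) ⟩
    _                       ∎
    where open ≤-Reasoning
  0<count-avoiding : 0 < count (λ T → inC T ∧ not (meets T X)) (allSubsets n)
  0<count-avoiding = m≤n⇒n<m+o⇒0<o meeting≤ <meeting+avoiding

-- Gadgets

induced : ∀ {k n} → Hypergraph k n → Subset n → Subset n → Bool
induced H V s = E H s ∧ ⌊ s ⊆? V ⌋

module _ {k n : ℕ} (H : Hypergraph k n) {V : Subset n} where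

  induced-edge : ∀ {s} → E H s ≡ true → s ⊆ V → induced H V s ≡ true
  induced-edge {s} s∈H s⊆V = cong₂ _∧_ s∈H (Equivalence.to T-≡ (fromWitness {a? = s ⊆? V} (λ {x} → s⊆V {x})))

  induced⇒E : ∀ s → induced H V s ≡ true → E H s ≡ true
  induced⇒E s s∈G = ∧-conicalˡ (E H s) _ s∈G

  induced⇒⊆ : ∀ s → induced H V s ≡ true → s ⊆ V
  induced⇒⊆ s s∈G = ⌊⌋≡true⁻ (∧-conicalʳ (E H s) _ s∈G)

  induced-perfectMatching : ∀ {M} → All (λ s → E H s ≡ true) M → AllPairs Disjoint M → ⋃ M ≡ V →
                            IsPerfectMatching V (induced H V) M
  induced-perfectMatching {M} edges disjoint refl =
    All.zipWith (λ (s∈H , s⊆⋃M) → induced-edge s∈H (λ {x} → s⊆⋃M {x})) (edges , ⊆-⋃ M) , disjoint , refl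

module _ {n r : ℕ} (c : Colouring n r) {i : Fin r} where

  colourCount-≡ : ∀ {s} ss → c s ≡ i → colourCount c (s ∷ ss) i ≡ suc (colourCount c ss i)
  colourCount-≡ {s} ss cs≡i with c s ≟ᶠ i
  ... | yes _   = refl
  ... | no cs≢i = contradiction cs≡i cs≢i

  colourCount-≢ : ∀ {s} ss → c s ≢ i → colourCount c (s ∷ ss) i ≡ colourCount c ss i
  colourCount-≢ {s} ss cs≢i with c s ≟ᶠ i
  ... | yes cs≡i = contradiction cs≡i cs≢i
  ... | no _     = refl

  colourCount-[-]≤1 : ∀ s → colourCount c (s ∷ []) i ≤ 1
  colourCount-[-]≤1 s with c s ≟ᶠ i
  ... | yes _ = ≤-refl
  ... | no _  = z≤n

record Configuration {k n r : ℕ} (H : Hypergraph k n) (c : Colouring n r) (i j : Fin r) : Set where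
  field
    v₁ v₂ v₃ v₄ : Fin n
    S T₁ T₂     : Subset n
    v₁≢v₃       : v₁ ≢ v₃
    v₁v₃S       : InLink H v₁ v₃ S
    v₂v₄S       : InLink H v₂ v₄ S
    T₁∈C[v₁v₂]  : InCiCj H c i j v₁ v₂ T₁
    T₂∈C[v₃v₄]  : InCiCj H c i j v₃ v₄ T₂
    separated   : AllPairs Disjoint (T₂ ∷ T₁ ∷ S ∷ ⁅ v₁ ⁆ ∷ ⁅ v₂ ⁆ ∷ ⁅ v₃ ⁆ ∷ ⁅ v₄ ⁆ ∷ [])

  e f : Subset n
  e = ⁅ v₁ ⁆ ∪ ⁅ v₃ ⁆ ∪ S
  f = ⁅ v₂ ⁆ ∪ ⁅ v₄ ⁆ ∪ S

module _ {k n r : ℕ} {H : Hypergraph k n} {c : Colouring n r} {i j : Fin r}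
         (config : Configuration H c i j) where
  open Configuration config
  open InCiCj

  private
    VG : Subset n
    VG = ⋃ (e ∷ ⁅ v₂ ⁆ ∷ ⁅ v₄ ⁆ ∷ T₁ ∷ T₂ ∷ [])

    M₁ M₂ : List (Subset n)
    M₁ = T₁ ∪ ⁅ v₂ ⁆ ∷ T₂ ∪ ⁅ v₄ ⁆ ∷ e ∷ []
    M₂ = T₁ ∪ ⁅ v₁ ⁆ ∷ T₂ ∪ ⁅ v₃ ⁆ ∷ f ∷ []

    matching₁ : IsPerfectMatching VG (induced H VG) M₁
    matching₁ = induced-perfectMatching H
      (proj₂ (T∈N[v] T₁∈C[v₁v₂]) ∷ proj₂ (T∈N[v] T₂∈C[v₃v₄]) ∷ InLink.uvS∈H v₁v₃S ∷ [])
      (pairUp-Disjoint (proj₁ (regroup-Disjoint separated)))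
      (⋃-pairUp e ⁅ v₂ ⁆ ⁅ v₄ ⁆ T₁ T₂)

    matching₂ : IsPerfectMatching VG (induced H VG) M₂
    matching₂ = induced-perfectMatching H
      (proj₂ (T∈N[u] T₁∈C[v₁v₂]) ∷ proj₂ (T∈N[u] T₂∈C[v₃v₄]) ∷ InLink.uvS∈H v₂v₄S ∷ [])
      (pairUp-Disjoint (proj₂ (regroup-Disjoint separated)))
      (trans (⋃-pairUp f ⁅ v₁ ⁆ ⁅ v₃ ⁆ T₁ T₂) ⋃f-side≡VG)
      where
      open CommutativeMonoidSolver (∪-commutativeMonoid n)
      ⋃f-side≡VG : ⋃ (f ∷ ⁅ v₁ ⁆ ∷ ⁅ v₃ ⁆ ∷ T₁ ∷ T₂ ∷ []) ≡ VG
      ⋃f-side≡VG = prove 7 ((x₂ ⊕ x₄ ⊕ s) ⊕ x₁ ⊕ x₃ ⊕ t₁ ⊕ t₂ ⊕ id) ((x₁ ⊕ x₃ ⊕ s) ⊕ x₂ ⊕ x₄ ⊕ t₁ ⊕ t₂ ⊕ id)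
                           (⁅ v₁ ⁆ ∷ ⁅ v₂ ⁆ ∷ ⁅ v₃ ⁆ ∷ ⁅ v₄ ⁆ ∷ S ∷ T₁ ∷ T₂ ∷ [])
        where
        x₁ x₂ x₃ x₄ s t₁ t₂ : Expr 7
        x₁ = var zero
        x₂ = var (suc zero)
        x₃ = var (suc (suc zero))
        x₄ = var (suc (suc (suc zero)))
        s  = var (suc (suc (suc (suc zero))))
        t₁ = var (suc (suc (suc (suc (suc zero)))))
        t₂ = var (suc (suc (suc (suc (suc (suc zero))))))

  gadget : Gadget H e f
  gadget = record
    { e₁ = v₁ ; e₂ = v₃ ; f₁ = v₂ ; f₂ = v₄ ; S = S ; T₁ = T₁ ; T₂ = T₂
    ; e₁≢e₂  = v₁≢v₃
    ; e₁∉S   = InLink.u∉S v₁v₃S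
    ; e₂∉S   = InLink.v∉S v₁v₃S
    ; S-size = trans (+-comm ∣ S ∣ 2) (InLink-size H v₁≢v₃ v₁v₃S)
    ; e-def  = refl
    ; f-def  = refl
    ; T₁-e₁  = T∈N[u] T₁∈C[v₁v₂]
    ; T₁-f₁  = T∈N[v] T₁∈C[v₁v₂]
    ; T₂-e₂  = T∈N[u] T₂∈C[v₃v₄]
    ; T₂-f₂  = T∈N[v] T₂∈C[v₃v₄]
    ; disj   = proj₁ (regroup-Disjoint separated)
    ; VG     = VG
    ; VG-def = refl
    ; EG     = induced H VG
    ; EG⊆EH  = induced⇒E H
    ; EG⊆VG  = induced⇒⊆ H
    ; e∈G    = All.head (All.tail (All.tail (proj₁ matching₁)))
    ; f∈G    = All.head (All.tail (All.tail (proj₁ matching₂)))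
    ; e₁T₁∈G = All.head (proj₁ matching₂)
    ; f₁T₁∈G = All.head (proj₁ matching₁)
    ; e₂T₂∈G = All.head (All.tail (proj₁ matching₂))
    ; f₂T₂∈G = All.head (All.tail (proj₁ matching₁))
    }

  gadget-good : i ≢ j → Good c gadget
  gadget-good i≢j =
    M₁ , M₂ , matching₁ , matching₂ ,
    λ same-profile → <-irrefl refl
      (≤-trans M₂-has-two (≤-trans (≤-reflexive (sym (same-profile i))) M₁-has-one))
    where
    M₁-has-one : colourCount c M₁ i ≤ 1
    M₁-has-one = begin
      colourCount c M₁ i
        ≡⟨ colourCount-≢ c (T₂ ∪ ⁅ v₄ ⁆ ∷ e ∷ []) (λ c≡i → i≢j (trans (sym c≡i) (colour-v T₁∈C[v₁v₂]))) ⟩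
      colourCount c (T₂ ∪ ⁅ v₄ ⁆ ∷ e ∷ []) i
        ≡⟨ colourCount-≢ c (e ∷ []) (λ c≡i → i≢j (trans (sym c≡i) (colour-v T₂∈C[v₃v₄]))) ⟩
      colourCount c (e ∷ []) i
        ≤⟨ colourCount-[-]≤1 c e ⟩
      1 ∎
      where open ≤-Reasoning
    M₂-has-two : 2 ≤ colourCount c M₂ i
    M₂-has-two = begin
      2
        ≤⟨ s≤s (s≤s z≤n) ⟩
      2 + colourCount c (f ∷ []) i
        ≡⟨ cong suc (colourCount-≡ c (f ∷ []) (colour-u T₂∈C[v₃v₄])) ⟨
      suc (colourCount c (T₂ ∪ ⁅ v₃ ⁆ ∷ f ∷ []) i)
        ≡⟨ colourCount-≡ c (T₂ ∪ ⁅ v₃ ⁆ ∷ f ∷ []) (colour-u T₁∈C[v₁v₂]) ⟨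
      colourCount c M₂ i ∎
      where open ≤-Reasoning

lemma2p5 : (k n r : ℕ) → 3 ≤ k →
    (H : Hypergraph k n) → (c : Colouring n r) →
    (i j : Fin r) → i ≢ j →
    (v₁ v₂ v₃ v₄ : Fin n) →
    v₁ ≢ v₂ → v₁ ≢ v₃ → v₁ ≢ v₄ → v₂ ≢ v₃ → v₂ ≢ v₄ → v₃ ≢ v₄ →
    (3 * k) * n ^ (k ∸ 2) ≤ CiCj H c i j v₁ v₂ →
    (3 * k) * n ^ (k ∸ 2) ≤ CiCj H c i j v₃ v₄ →
    (∀ (u v : Fin n) → u ≢ v → n C (k ∸ 2) < 2 * codeg H u v) →
    Σ (Subset n) λ e → Σ (Subset n) λ f →
      (E H e ≡ true) × (E H f ≡ true) ×
      Σ (Gadget H e f) λ G → Good c G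
lemma2p5 k@(suc (suc (suc m))) (suc n) r (s≤s (s≤s (s≤s _))) H c i j i≢j v₁ v₂ v₃ v₄
         v₁≢v₂ v₁≢v₃ v₁≢v₄ v₂≢v₃ v₂≢v₄ v₃≢v₄ dense₁₂ dense₃₄ codeg-large =
  let S , v₁v₃S , v₂v₄S = common-link H v₁≢v₃ v₂≢v₄ (codeg-large v₁ v₃ v₁≢v₃) (codeg-large v₂ v₄ v₂≢v₄)
      T₁ , T₁∈C , T₁#X₁ = CiCj-avoiding H c (3 * k) (⋃ (S ∷ singletons)) (∣X₁∣<3k v₁v₃S) dense₁₂
      T₂ , T₂∈C , T₂#X₂ = CiCj-avoiding H c (3 * k) (⋃ (T₁ ∷ S ∷ singletons))
                                         (∣X₂∣<3k v₁v₃S (InCiCj.T∈N[u] T₁∈C)) dense₃₄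
      config : Configuration H c i j
      config = record
        { v₁ = v₁ ; v₂ = v₂ ; v₃ = v₃ ; v₄ = v₄ ; S = S ; T₁ = T₁ ; T₂ = T₂
        ; v₁≢v₃ = v₁≢v₃ ; v₁v₃S = v₁v₃S ; v₂v₄S = v₂v₄S ; T₁∈C[v₁v₂] = T₁∈C ; T₂∈C[v₃v₄] = T₂∈C
        ; separated = Disjoint-⋃⁻ (T₁ ∷ S ∷ singletons) T₂#X₂ ∷ Disjoint-⋃⁻ (S ∷ singletons) T₁#X₁
                    ∷ S#singletons v₁v₃S v₂v₄S ∷ singletons-separated
        }
  in Configuration.e config , Configuration.f config , InLink.uvS∈H v₁v₃S , InLink.uvS∈H v₂v₄S ,
     gadget config , gadget-good config i≢j
  where
  singletons : List (Subset (suc n))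
  singletons = ⁅ v₁ ⁆ ∷ ⁅ v₂ ⁆ ∷ ⁅ v₃ ⁆ ∷ ⁅ v₄ ⁆ ∷ []

  singletons-separated : AllPairs Disjoint singletons
  singletons-separated =
    (≢⇒Disjoint-⁅⁆ v₁≢v₂ ∷ ≢⇒Disjoint-⁅⁆ v₁≢v₃ ∷ ≢⇒Disjoint-⁅⁆ v₁≢v₄ ∷ [])
    ∷ (≢⇒Disjoint-⁅⁆ v₂≢v₃ ∷ ≢⇒Disjoint-⁅⁆ v₂≢v₄ ∷ []) ∷ (≢⇒Disjoint-⁅⁆ v₃≢v₄ ∷ []) ∷ [] ∷ []

  S#singletons : ∀ {S} → InLink H v₁ v₃ S → InLink H v₂ v₄ S → All (Disjoint S) singletons
  S#singletons v₁v₃S v₂v₄S =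
    ∉⇒Disjoint-⁅⁆ (InLink.u∉S v₁v₃S) ∷ ∉⇒Disjoint-⁅⁆ (InLink.u∉S v₂v₄S)
    ∷ ∉⇒Disjoint-⁅⁆ (InLink.v∉S v₁v₃S) ∷ ∉⇒Disjoint-⁅⁆ (InLink.v∉S v₂v₄S) ∷ []

  ∣X₁∣≤ : ∀ {S} → InLink H v₁ v₃ S → ∣ ⋃ (S ∷ singletons) ∣ ≤ suc m + 4
  ∣X₁∣≤ {S} v₁v₃S = ≤-trans (∣⋃ps∣≤sum (S ∷ singletons)) (≤-reflexive sizes)
    where
    sizes : sum (map ∣_∣ (S ∷ singletons)) ≡ suc m + 4
    sizes rewrite suc-injective (suc-injective (InLink-size H v₁≢v₃ v₁v₃S))
                | ∣⁅x⁆∣≡1 v₁ | ∣⁅x⁆∣≡1 v₂ | ∣⁅x⁆∣≡1 v₃ | ∣⁅x⁆∣≡1 v₄ = refl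

  2m+7<3k : suc (suc m) + (suc m + 4) < 3 * k
  2m+7<3k = subst (suc (suc (suc m) + (suc m + 4)) ≤_) (3k≡ m) (m≤m+n _ (suc m))
    where
    3k≡ : ∀ m → suc (suc (suc m) + (suc m + 4)) + suc m ≡ 3 * (3 + m)
    3k≡ = solve-∀

  ∣X₁∣<3k : ∀ {S} → InLink H v₁ v₃ S → ∣ ⋃ (S ∷ singletons) ∣ < 3 * k
  ∣X₁∣<3k v₁v₃S = ≤-<-trans (∣X₁∣≤ v₁v₃S) (≤-<-trans (m≤n+m (suc m + 4) (suc (suc m))) 2m+7<3k)

  ∣X₂∣<3k : ∀ {S T} → InLink H v₁ v₃ S → InNbhd H v₁ T → ∣ ⋃ (T ∷ S ∷ singletons) ∣ < 3 * k
  ∣X₂∣<3k {S} {T} v₁v₃S T∈N[v₁] =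
    ≤-<-trans (∣p∪q∣≤∣p∣+∣q∣ T _)
              (≤-<-trans (+-mono-≤ (≤-reflexive (suc-injective (InNbhd-size H T∈N[v₁]))) (∣X₁∣≤ v₁v₃S)) 2m+7<3k)
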